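{- Let $n\ge 13$, let $Q$ be a query graph on an $n$-element vertex set $V$ with minimum degree at least $n-3$, and suppose the answers $q(x,y)$ to all pairs $xy\in E(Q)$ have been received for some hidden tree on $V$. Then for every pair of consistent trees $T_0,T_1$ there is a vertex $z$ such that for every vertex $v$ the distance of $z$ and $v$ is the same in $T_0$ and in $T_1$.
   Context: The answer $q(x,y)$ to a queried pair is the distance of $x$ and $y$ in the hidden tree. A tree on $V$ is consistent if for every edge $xy$ of $Q$ its distance between $x$ and $y$ equals $q(x,y)$. -}

module Defs where

open import Data.Nat using (ℕ; _≤_; _∸_)
open import Data.Bool using (Bool; true; false; T)
open import Data.Fin using (Fin)
open import Data.List using (List; []; _∷_; length; filter; head; last)
open import Data.List.Relation.Unary.Unique.Propositional using (Unique)
open import Data.Maybe using (Maybe; just)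
open import Data.Product using (_×_; ∃-syntax)
open import Data.Vec.Functional using ()
open import Data.Fin.Subset using ()
open import Relation.Binary.PropositionalEquality using (_≡_)
open import Relation.Nullary using (¬_)
open import Relation.Nullary.Decidable using (does)
open import Data.List using (allFin)

record Graph (n : ℕ) : Set where
  field
    adj   : Fin n → Fin n → Bool
    sym   : ∀ x y → adj x y ≡ adj y x
    irrefl : ∀ x → adj x x ≡ false
open Graph public

Adj : ∀ {n} → Graph n → Fin n → Fin n → Set
Adj G x y = T (adj G x y)

data Walk {n} (G : Graph n) : Fin n → Fin n → ℕ → Set where
  here : ∀ {x} → Walk G x x 0
  step : ∀ {x y z k} → Adj G x y → Walk G y z k → Walk G x z (ℕ.suc k)

vertices : ∀ {n} {G : Graph n} {x y k} → Walk G x y k → List (Fin n)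
vertices {x = x} here = x ∷ []
vertices {x = x} (step _ w) = x ∷ vertices w

IsPath : ∀ {n} {G : Graph n} {x y k} → Walk G x y k → Set
IsPath w = Unique (vertices w)

IsTree : ∀ {n} → Graph n → Set
IsTree G = ∀ x y →
  (∃[ k ] ∃[ w ] IsPath {G = G} {x} {y} {k} w) ×
  (∀ {k k'} (w : Walk G x y k) (w' : Walk G x y k') →
     IsPath w → IsPath w' → vertices w ≡ vertices w')

Dist : ∀ {n} → Graph n → Fin n → Fin n → ℕ → Set
Dist G x y d = Walk G x y d × (∀ {k} → Walk G x y k → d ≤ k)

degree : ∀ {n} → Graph n → Fin n → ℕ
degree {n} G x = length (filter (λ y → Data.Bool._≟_ (adj G x y) true) (allFin n))

-- T is consistent with the answers of the hidden tree H on the queries Q: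
-- for every edge xy of Q, dist_T(x,y) = q(x,y) = dist_H(x,y).
Consistent : ∀ {n} → Graph n → Graph n → Graph n → Set
Consistent Q H T = ∀ x y → Adj Q x y → ∀ d →
  (Dist H x y d → Dist T x y d) × (Dist T x y d → Dist H x y d)

{-# OPTIONS --safe #-}
-- Let z be a median of T₀, i.e. a vertex minimising the total T₀-distance.
-- Stepping from z towards any a ≠ z brings every vertex on a's side of z
-- closer, so at least half of the vertices, hence at least 7, lie behind z
-- as seen from a.  Each vertex misses at most 3 queries.  If za is not a
-- query, counting yields w behind z from a with zw, aw queried, and then w′
-- behind z from w with zw′, aw′, ww′ queried.  Now
--   d₀ a z + d₀ z w = d₀ a w = d₁ a w ≤ d₁ a z + d₁ z w = d₁ a z + d₀ z w,
-- and the four-point condition of T₁ for a, z, w, w′, all of whose pairs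
-- except az are queries, bounds d₁ a z + d₀ w w′ by d₀ a z + d₀ w w′.

module Submission where

open import Defs
open import Data.Nat.Properties
open import Algebra.Properties.CommutativeMonoid.Sum +-0-commutativeMonoid
  using (sum; ∑-distrib-+; sum-cong-≗)
open import Algebra.Properties.CommutativeSemigroup +-commutativeSemigroup
  using (xy∙z≈x∙zy)
open import Data.Bool using (Bool; true; false; T; not; _∧_; _∨_; if_then_else_)
  renaming (_≟_ to _≟ᵇ_)
open import Data.Bool.Properties using (T-∧; T-∨)
open import Data.Empty using (⊥-elim)
open import Data.Fin using (Fin; zero; suc; fromℕ<) renaming (_≟_ to _≟ᶠ_)
open import Data.Fin.Properties using (any?)
open import Data.List using (_∷_; length; _++_; filter; tabulate; allFin)
open import Data.List.Extrema.Nat using (argmin; f[argmin]≤f[xs])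
open import Data.List.Membership.Propositional using (_∈_)
open import Data.List.Membership.Propositional.Properties using (∈-allFin)
open import Data.List.Relation.Unary.All as All using ([])
open import Data.List.Relation.Unary.AllPairs using ([]; _∷_)
open import Data.List.Relation.Unary.Any using (here; there)
open import Data.List.Relation.Unary.Unique.Propositional using (Unique)
open import Data.List.Relation.Unary.Unique.Propositional.Properties using (++⁺)
open import Data.Nat
  using (ℕ; zero; suc; _+_; _∸_; _≤_; _<_; _⊔_; z≤n; s≤s)
open import Data.Nat.Induction using (<-rec)
open import Data.Product using (_×_; _,_; proj₁; proj₂; ∃-syntax)
open import Data.Sum using (inj₁; inj₂)
open import Data.Unit using (tt)
open import Function using (_∘_; Equivalence)
open import Relation.Binary.PropositionalEquality as ≡
  using (_≡_; _≢_; refl; cong; cong₂; subst; trans)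
open import Relation.Nullary using (¬_; yes; no; contradiction)
open import Relation.Nullary.Decidable
  using (⌊_⌋; map′; T?; _×-dec_; toWitness; fromWitness; fromWitnessFalse)
open import Relation.Unary using (Decidable)

least-witness : ∀ {P : ℕ → Set} → Decidable P → ∀ {k} → P k →
                ∃[ m ] (P m × ∀ {j} → P j → m ≤ j)
least-witness {P} P? {k} = <-rec (λ k → P k → Least) search k
  where
  Least : Set
  Least = ∃[ m ] (P m × ∀ {j} → P j → m ≤ j)
  search : ∀ k → (∀ {j} → j < k → P j → Least) → P k → Least
  search k smaller pk with anyUpTo? P? k
  ... | yes (j , j<k , pj) = smaller j<k pj
  ... | no none            = k , pk , λ pj → ≮⇒≥ λ j<k → none (_ , j<k , pj)

Adj-sym : ∀ {n} (G : Graph n) {x y} → Adj G x y → Adj G y x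
Adj-sym G {x} {y} = subst T (sym G x y)

Adj⇒≢ : ∀ {n} (G : Graph n) {x y} → Adj G x y → x ≢ y
Adj⇒≢ G {x} xy refl = subst T (irrefl G x) xy

module Walks {n} (G : Graph n) where

  infixr 5 _++ʷ_
  _++ʷ_ : ∀ {x y z k m} → Walk G x y k → Walk G y z m → Walk G x z (k + m)
  here     ++ʷ w = w
  step e v ++ʷ w = step e (v ++ʷ w)

  _∷ʳʷ_ : ∀ {x y z k} → Walk G x y k → Adj G y z → Walk G x z (suc k)
  here      ∷ʳʷ e = step e here
  step e′ w ∷ʳʷ e = step e′ (w ∷ʳʷ e)

  reverse : ∀ {x y k} → Walk G x y k → Walk G y x k
  reverse here       = here
  reverse (step e w) = reverse w ∷ʳʷ Adj-sym G e

  length-vertices : ∀ {x y k} (w : Walk G x y k) → length (vertices w) ≡ suc k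
  length-vertices here       = refl
  length-vertices (step _ w) = cong suc (length-vertices w)

  vertices-++ʷ-step : ∀ {x y y′ z k m} (v : Walk G x y k) (e : Adj G y y′) (w : Walk G y′ z m) →
                      vertices (v ++ʷ step e w) ≡ vertices v ++ vertices w
  vertices-++ʷ-step here       e w = refl
  vertices-++ʷ-step (step _ v) e w = cong (_ ∷_) (vertices-++ʷ-step v e w)

  splitAt : ∀ {x y k v} (w : Walk G x y k) → v ∈ vertices w →
            ∃[ k₁ ] ∃[ k₂ ] (Walk G x v k₁ × Walk G v y k₂ × k₁ + k₂ ≡ k)
  splitAt here       (here refl) = 0 , 0 , here , here , refl
  splitAt (step e w) (here refl) = 0 , _ , here , step e w , refl
  splitAt (step e w) (there v∈w) =
    let k₁ , k₂ , w₁ , w₂ , k₁+k₂≡k = splitAt w v∈w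
    in suc k₁ , k₂ , step e w₁ , w₂ , cong suc k₁+k₂≡k

  walk? : ∀ x y → Decidable (Walk G x y)
  walk? x y zero with x ≟ᶠ y
  ... | yes refl = yes here
  ... | no x≢y   = no λ { here → x≢y refl }
  walk? x y (suc k) =
    map′ (λ (_ , e , w) → step e w) (λ { (step e w) → _ , e , w })
         (any? λ u → T? (adj G x u) ×-dec walk? u y k)

  shortest⇒IsPath : ∀ {x y k} (w : Walk G x y k) → (∀ {j} → Walk G x y j → k ≤ j) → IsPath w
  shortest⇒IsPath here       _        = [] ∷ []
  shortest⇒IsPath {x} (step e w) shortest =
    All.tabulate x∉w ∷ shortest⇒IsPath w (λ w′ → ≤-pred (shortest (step e w′)))
    where
    x∉w : ∀ {v} → v ∈ vertices w → x ≢ v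
    x∉w v∈w refl =
      let k₁ , k₂ , _ , w₂ , k₁+k₂≡k = splitAt w v∈w
      in 1+n≰n (≤-trans (shortest w₂) (subst (k₂ ≤_) k₁+k₂≡k (m≤n+m k₂ k₁)))

Connected : ∀ {n} → Graph n → Set
Connected {n} G = ∀ (x y : Fin n) → ∃[ k ] Walk G x y k

module Distance {n} {G : Graph n} (connected : Connected G) where
  open Walks G

  Dist-exists : ∀ x y → ∃[ m ] Dist G x y m
  Dist-exists x y = least-witness (walk? x y) (proj₂ (connected x y))

  d : Fin n → Fin n → ℕ
  d x y = proj₁ (Dist-exists x y)

  Dist-d : ∀ x y → Dist G x y (d x y)
  Dist-d x y = proj₂ (Dist-exists x y)

  geodesic : ∀ x y → Walk G x y (d x y)
  geodesic x y = proj₁ (Dist-d x y)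

  d-minimal : ∀ {x y k} → Walk G x y k → d x y ≤ k
  d-minimal = proj₂ (Dist-d _ _)

  Dist⇒≡d : ∀ {x y m} → Dist G x y m → m ≡ d x y
  Dist⇒≡d (w , shortest) = ≤-antisym (shortest (geodesic _ _)) (d-minimal w)

  ≡d⇒Dist : ∀ {x y m} → m ≡ d x y → Dist G x y m
  ≡d⇒Dist refl = Dist-d _ _

  geodesic-isPath : ∀ x y → IsPath (geodesic x y)
  geodesic-isPath x y = shortest⇒IsPath (geodesic x y) d-minimal

  d-refl : ∀ x → d x x ≡ 0
  d-refl x = n≤0⇒n≡0 (d-minimal {x} here)

  d≡0⇒≡ : ∀ {x y} → d x y ≡ 0 → x ≡ y
  d≡0⇒≡ {x} {y} dxy≡0 = endpoints (subst (Walk G x y) dxy≡0 (geodesic x y))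
    where
    endpoints : Walk G x y 0 → x ≡ y
    endpoints here = refl

  d-sym : ∀ x y → d x y ≡ d y x
  d-sym x y = ≤-antisym (d-minimal (reverse (geodesic y x))) (d-minimal (reverse (geodesic x y)))

  d-triangle : ∀ x y z → d x z ≤ d x y + d y z
  d-triangle x y z = d-minimal (geodesic x y ++ʷ geodesic y z)

  Adj⇒d≤1 : ∀ {x y} → Adj G x y → d x y ≤ 1
  Adj⇒d≤1 e = d-minimal (step e here)

  d-step : ∀ {x y k} → d x y ≡ suc k → ∃[ x′ ] (Adj G x x′ × d x′ y ≡ k)
  d-step {x} {y} {k} dxy≡1+k = first-step (subst (Walk G x y) dxy≡1+k (geodesic x y))
    where
    first-step : Walk G x y (suc k) → ∃[ x′ ] (Adj G x x′ × d x′ y ≡ k)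
    first-step (step {y = x′} e w) = x′ , e , ≤-antisym (d-minimal w)
      (≤-pred (subst (_≤ suc (d x′ y)) dxy≡1+k (d-minimal (step e (geodesic x′ y)))))

  Between : Fin n → Fin n → Fin n → Set
  Between x y z = d x y + d y z ≡ d x z

  between? : Fin n → Fin n → Fin n → Bool
  between? x y z = ⌊ d x y + d y z ≟ d x z ⌋

  Between-sym : ∀ {x y z} → Between x y z → Between z y x
  Between-sym {x} {y} {z} xyz = begin
    d z y + d y x  ≡⟨ cong₂ _+_ (d-sym z y) (d-sym y x) ⟩
    d y z + d x y  ≡⟨ +-comm (d y z) (d x y) ⟩
    d x y + d y z  ≡⟨ xyz ⟩
    d x z          ≡⟨ d-sym x z ⟩
    d z x          ∎
    where open ≡.≡-Reasoning

  Between-endpoint : ∀ x y → Between x y y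
  Between-endpoint x y = trans (cong (d x y +_) (d-refl y)) (+-identityʳ (d x y))

  ¬Between-loop : ∀ {x y} → x ≢ y → ¬ Between x y x
  ¬Between-loop {x} {y} x≢y xyx =
    x≢y (d≡0⇒≡ (m+n≡0⇒m≡0 (d x y) (trans xyx (d-refl x))))

  Between-geodesic : ∀ {x y k v} (w : Walk G x y k) → k ≡ d x y → v ∈ vertices w → Between x v y
  Between-geodesic {x} {y} {v = v} w k≡dxy v∈w =
    let k₁ , k₂ , w₁ , w₂ , k₁+k₂≡k = splitAt w v∈w
    in ≤-antisym (subst (d x v + d v y ≤_) (trans k₁+k₂≡k k≡dxy)
                        (+-mono-≤ (d-minimal w₁) (d-minimal w₂)))
                 (d-triangle x v y)

  Between⇒four-point : ∀ {u x y} v → Between u x y → d x y + d u v ≤ d x v + d y u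
  Between⇒four-point {u} {x} {y} v uxy = begin
    d x y + d u v            ≤⟨ +-monoʳ-≤ (d x y) (d-triangle u x v) ⟩
    d x y + (d u x + d x v)  ≡⟨ +-assoc (d x y) (d u x) (d x v) ⟨
    d x y + d u x + d x v    ≡⟨ cong (_+ d x v) (trans (+-comm (d x y) (d u x)) uxy) ⟩
    d u y + d x v            ≡⟨ trans (+-comm (d u y) (d x v)) (cong (d x v +_) (d-sym u y)) ⟩
    d x v + d y u            ∎
    where open ≤-Reasoning

IsTree⇒Connected : ∀ {n} {G : Graph n} → IsTree G → Connected G
IsTree⇒Connected tree x y = let k , w , _ = proj₁ (tree x y) in k , w

module TreeDistance {n} {G : Graph n} (tree : IsTree G) where
  open Walks G
  open Distance (IsTree⇒Connected tree) public

  IsPath⇒≡d : ∀ {x y k} (w : Walk G x y k) → IsPath w → k ≡ d x y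
  IsPath⇒≡d {x} {y} {k} w w-path = suc-injective (begin
    suc k                             ≡⟨ length-vertices w ⟨
    length (vertices w)               ≡⟨ cong length (proj₂ (tree x y) w _ w-path (geodesic-isPath x y)) ⟩
    length (vertices (geodesic x y))  ≡⟨ length-vertices (geodesic x y) ⟩
    suc (d x y)                       ∎)
    where open ≡.≡-Reasoning

  -- The geodesic u → x, the edge x x′ and the geodesic x′ → y form a path,
  -- and in a tree every path is a geodesic.
  Between-through-edge : ∀ {x x′ y u} → Adj G x x′ → d x y ≡ suc (d x′ y) →
                         d x u ≤ d x′ u → Between u x y
  Between-through-edge {x} {x′} {y} {u} e x′-closer u-not-closer =
    trans (cong (d u x +_) x′-closer) (IsPath⇒≡d detour detour-isPath)
    where
    detour : Walk G u y (d u x + suc (d x′ y))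
    detour = geodesic u x ++ʷ step e (geodesic x′ y)

    disjoint : ∀ {v} → ¬ (v ∈ vertices (geodesic u x) × v ∈ vertices (geodesic x′ y))
    disjoint {v} (v∈ux , v∈x′y) = <⇒≱ x′u<xu u-not-closer
      where
      xv≡1+x′v : d x v ≡ suc (d x′ v)
      xv≡1+x′v = +-cancelʳ-≡ (d v y) (d x v) (suc (d x′ v)) (begin
        d x v + d v y         ≡⟨ Between-geodesic (step e (geodesic x′ y)) (≡.sym x′-closer) (there v∈x′y) ⟩
        d x y                 ≡⟨ x′-closer ⟩
        suc (d x′ y)          ≡⟨ cong suc (Between-geodesic (geodesic x′ y) refl v∈x′y) ⟨
        suc (d x′ v + d v y)  ∎)
        where open ≡.≡-Reasoning
      x′u<xu : d x′ u < d x u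
      x′u<xu = begin-strict
        d x′ u         ≤⟨ d-triangle x′ v u ⟩
        d x′ v + d v u <⟨ +-monoˡ-< (d v u) (≤-reflexive (≡.sym xv≡1+x′v)) ⟩
        d x v + d v u  ≡⟨ Between-sym (Between-geodesic (geodesic u x) refl v∈ux) ⟩
        d x u          ∎
        where open ≤-Reasoning

    detour-isPath : IsPath detour
    detour-isPath = subst Unique (≡.sym (vertices-++ʷ-step (geodesic u x) e (geodesic x′ y)))
                          (++⁺ (geodesic-isPath u x) (geodesic-isPath x′ y) disjoint)

  four-point-step : ∀ {x x′ y} u v → Adj G x x′ → d x y ≡ suc (d x′ y) →
                    d x′ y + d u v ≤ (d x′ u + d y v) ⊔ (d x′ v + d y u) →
                    d x y + d u v ≤ (d x u + d y v) ⊔ (d x v + d y u)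
  four-point-step {x} {x′} {y} u v e x′-closer x′-four-point with d x u ≤? d x′ u | d x v ≤? d x′ v
  ... | yes u-far | _ =
    ≤-trans (Between⇒four-point v (Between-through-edge e x′-closer u-far)) (m≤n⊔m _ _)
  ... | _ | yes v-far = begin
    d x y + d u v  ≡⟨ cong (d x y +_) (d-sym u v) ⟩
    d x y + d v u  ≤⟨ Between⇒four-point u (Between-through-edge e x′-closer v-far) ⟩
    d x u + d y v  ≤⟨ m≤m⊔n _ _ ⟩
    (d x u + d y v) ⊔ (d x v + d y u) ∎
    where open ≤-Reasoning
  ... | no u-near | no v-near = begin
    d x y + d u v                              ≡⟨ cong (_+ d u v) x′-closer ⟩
    suc (d x′ y + d u v)                       ≤⟨ s≤s x′-four-point ⟩
    suc ((d x′ u + d y v) ⊔ (d x′ v + d y u))  ≤⟨ ⊔-mono-≤ (+-monoˡ-< (d y v) (≰⇒> u-near))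
                                                             (+-monoˡ-< (d y u) (≰⇒> v-near)) ⟩
    (d x u + d y v) ⊔ (d x v + d y u)          ∎
    where open ≤-Reasoning

  four-point : ∀ x y u v → d x y + d u v ≤ (d x u + d y v) ⊔ (d x v + d y u)
  four-point x y = induct (d x y) x refl
    where
    induct : ∀ k x → d x y ≡ k → ∀ u v → d x y + d u v ≤ (d x u + d y v) ⊔ (d x v + d y u)
    induct zero x dxy≡0 u v with refl ← d≡0⇒≡ dxy≡0 =
      ≤-trans (Between⇒four-point v (Between-endpoint u x)) (m≤n⊔m _ _)
    induct (suc k) x dxy≡1+k u v =
      let x′ , e , x′y≡k = d-step dxy≡1+k
      in four-point-step u v e (trans dxy≡1+k (cong suc (≡.sym x′y≡k))) (induct k x′ x′y≡k u v)

∑-mono-≤ : ∀ {n} {f g : Fin n → ℕ} → (∀ i → f i ≤ g i) → sum f ≤ sum g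
∑-mono-≤ {zero}  f≤g = z≤n
∑-mono-≤ {suc n} f≤g = +-mono-≤ (f≤g zero) (∑-mono-≤ (f≤g ∘ suc))

∑-const-1 : ∀ n → sum {n} (λ _ → 1) ≡ n
∑-const-1 zero    = refl
∑-const-1 (suc n) = cong suc (∑-const-1 n)

term≤∑ : ∀ {n} (f : Fin n → ℕ) i → f i ≤ sum f
term≤∑ f zero    = m≤m+n (f zero) _
term≤∑ f (suc i) = ≤-trans (term≤∑ (f ∘ suc) i) (m≤n+m _ (f zero))

¬T⇒T-not : ∀ {b} → ¬ T b → T (not b)
¬T⇒T-not {false} _  = tt
¬T⇒T-not {true}  ¬t = ¬t tt

T-not⇒¬T : ∀ {b} → T (not b) → ¬ T b
T-not⇒¬T {false} _ ()

¬T-not⇒T : ∀ {b} → ¬ T (not b) → T b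
¬T-not⇒T {true}  _  = tt
¬T-not⇒T {false} ¬t = ¬t tt

¬T-∨ : ∀ {a b} → ¬ T (a ∨ b) → ¬ T a × ¬ T b
¬T-∨ ¬a∨b = ¬a∨b ∘ Equivalence.from T-∨ ∘ inj₁ , ¬a∨b ∘ Equivalence.from T-∨ ∘ inj₂

indicator : Bool → ℕ
indicator b = if b then 1 else 0

count : ∀ {n} → (Fin n → Bool) → ℕ
count p = sum (indicator ∘ p)

module _ {n} (p : Fin n → Bool) where

  count-complement : count p + count (not ∘ p) ≡ n
  count-complement = begin
    count p + count (not ∘ p)                            ≡⟨ ∑-distrib-+ (indicator ∘ p) (indicator ∘ not ∘ p) ⟨
    sum (λ i → indicator (p i) + indicator (not (p i)))  ≡⟨ sum-cong-≗ (λ i → one-of (p i)) ⟩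
    sum {n} (λ _ → 1)                                    ≡⟨ ∑-const-1 n ⟩
    n                                                    ∎
    where
    open ≡.≡-Reasoning
    one-of : ∀ b → indicator b + indicator (not b) ≡ 1
    one-of true  = refl
    one-of false = refl

  count-split : ∀ (q : Fin n → Bool) →
                count p ≡ count (λ i → p i ∧ q i) + count (λ i → p i ∧ not (q i))
  count-split q = trans (sum-cong-≗ (λ i → split (p i) (q i)))
    (∑-distrib-+ (λ i → indicator (p i ∧ q i)) (λ i → indicator (p i ∧ not (q i))))
    where
    split : ∀ a b → indicator a ≡ indicator (a ∧ b) + indicator (a ∧ not b)
    split true  true  = refl
    split true  false = refl
    split false _     = refl

  count-∨ : ∀ (q : Fin n → Bool) →
            count (λ i → p i ∨ q i) + count (λ i → p i ∧ q i) ≡ count p + count q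
  count-∨ q = begin
    count (λ i → p i ∨ q i) + count (λ i → p i ∧ q i)
      ≡⟨ ∑-distrib-+ (λ i → indicator (p i ∨ q i)) (λ i → indicator (p i ∧ q i)) ⟨
    sum (λ i → indicator (p i ∨ q i) + indicator (p i ∧ q i))
      ≡⟨ sum-cong-≗ (λ i → inclusion-exclusion (p i) (q i)) ⟩
    sum (λ i → indicator (p i) + indicator (q i))
      ≡⟨ ∑-distrib-+ (indicator ∘ p) (indicator ∘ q) ⟩
    count p + count q
      ∎
    where
    open ≡.≡-Reasoning
    inclusion-exclusion : ∀ a b → indicator (a ∨ b) + indicator (a ∧ b) ≡ indicator a + indicator b
    inclusion-exclusion true  true  = refl
    inclusion-exclusion true  false = refl
    inclusion-exclusion false true  = refl
    inclusion-exclusion false false = refl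

  count-∨-≤ : ∀ (q : Fin n → Bool) → count (λ i → p i ∨ q i) ≤ count p + count q
  count-∨-≤ q = subst (count (λ i → p i ∨ q i) ≤_) (count-∨ q) (m≤m+n _ _)

  count-mono : ∀ {q : Fin n → Bool} → (∀ i → T (p i) → T (q i)) → count p ≤ count q
  count-mono {q} p⊆q = ∑-mono-≤ (λ i → indicator-mono (p i) (q i) (p⊆q i))
    where
    indicator-mono : ∀ a b → (T a → T b) → indicator a ≤ indicator b
    indicator-mono true  true  _   = ≤-refl
    indicator-mono true  false a⇒b = ⊥-elim (a⇒b tt)
    indicator-mono false _     _   = z≤n

  T⇒0<count : ∀ {i} → T (p i) → 0 < count p
  T⇒0<count {i} pi = ≤-trans (indicator-T pi) (term≤∑ (indicator ∘ p) i)
    where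
    indicator-T : ∀ {b} → T b → 1 ≤ indicator b
    indicator-T {true} _ = ≤-refl

0<count⇒∃ : ∀ {n} (p : Fin n → Bool) → 0 < count p → ∃[ i ] T (p i)
0<count⇒∃ {suc n} p 0<count with p zero in p0
... | true  = zero , subst T (≡.sym p0) tt
... | false = let i , pi = 0<count⇒∃ (p ∘ suc) 0<count in suc i , pi

two-points⇒2≤count : ∀ {n} (p : Fin n → Bool) {x y} → x ≢ y → T (p x) → T (p y) → 2 ≤ count p
two-points⇒2≤count p {x} {y} x≢y px py = subst (2 ≤_) (≡.sym (count-split p is-x))
  (+-mono-≤ (T⇒0<count (λ v → p v ∧ is-x v)
                        (Equivalence.from T-∧ (px , fromWitness refl)))
            (T⇒0<count (λ v → p v ∧ not (is-x v))
                        (Equivalence.from T-∧ (py , fromWitnessFalse (x≢y ∘ ≡.sym)))))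
  where
  is-x : Fin _ → Bool
  is-x v = ⌊ v ≟ᶠ x ⌋

count-∧<count : ∀ {n} (p q : Fin n → Bool) {x} → T (p x) → ¬ T (q x) →
                count (λ i → p i ∧ q i) < count p
count-∧<count p q {x} px ¬qx = subst (count (λ i → p i ∧ q i) <_) (≡.sym (count-split p q))
  (m<m+n (count (λ i → p i ∧ q i))
     (T⇒0<count (λ i → p i ∧ not (q i)) (Equivalence.from T-∧ (px , ¬T⇒T-not ¬qx))))

pigeonhole : ∀ {n} (p q : Fin n → Bool) → count q < count p → ∃[ i ] (T (p i) × ¬ T (q i))
pigeonhole p q q<p =
  let i , pi∧¬qi = 0<count⇒∃ (λ i → p i ∧ not (q i)) 0<count
      pi , ¬qi   = Equivalence.to T-∧ pi∧¬qi
  in i , pi , T-not⇒¬T ¬qi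
  where
  0<count : 0 < count (λ i → p i ∧ not (q i))
  0<count = +-cancelˡ-< (count q) 0 _ (begin-strict
    count q + 0                                              ≡⟨ +-identityʳ (count q) ⟩
    count q                                                  <⟨ q<p ⟩
    count p                                                  ≡⟨ count-split p q ⟩
    count (λ i → p i ∧ q i) + count (λ i → p i ∧ not (q i))  ≤⟨ +-monoˡ-≤ _ p∧q≤q ⟩
    count q + count (λ i → p i ∧ not (q i))                  ∎)
    where
    open ≤-Reasoning
    p∧q≤q : count (λ i → p i ∧ q i) ≤ count q
    p∧q≤q = count-mono (λ i → p i ∧ q i) (λ i → proj₂ ∘ Equivalence.to T-∧)

degree≡count : ∀ {n} (G : Graph n) x → degree G x ≡ count (adj G x)
degree≡count G x = filter-tabulate (adj G x) (λ i → i)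
  where
  filter-tabulate : ∀ {m} {A : Set} (p : A → Bool) (f : Fin m → A) →
                    length (filter (λ a → p a ≟ᵇ true) (tabulate f)) ≡ count (p ∘ f)
  filter-tabulate {zero}  p f = refl
  filter-tabulate {suc m} p f with p (f zero)
  ... | true  = cong suc (filter-tabulate p (f ∘ suc))
  ... | false = filter-tabulate p (f ∘ suc)

∃-minimiser : ∀ {n} → Fin n → (f : Fin n → ℕ) → ∃[ z ] (∀ y → f z ≤ f y)
∃-minimiser {n} x₀ f =
  argmin f x₀ (allFin n) , λ y → All.lookup (f[argmin]≤f[xs] x₀ (allFin n)) (∈-allFin y)

module Median {n} {G : Graph n} (tree : IsTree G) where
  open TreeDistance tree

  IsMedian : Fin n → Set
  IsMedian z = ∀ y → sum (d z) ≤ sum (d y)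

  median-balanced : ∀ {z a} → IsMedian z → a ≢ z →
                    count (not ∘ between? a z) ≤ count (between? a z)
  median-balanced {z} {a} median a≢z with d z a in za
  ... | zero  = ⊥-elim (a≢z (≡.sym (d≡0⇒≡ za)))
  ... | suc k with x′ , e , refl ← d-step za = +-cancelʳ-≤ (sum (d z)) _ _ (begin
    count off + sum (d z)                           ≤⟨ +-monoʳ-≤ (count off) (median x′) ⟩
    count off + sum (d x′)                          ≡⟨ ∑-distrib-+ (indicator ∘ off) (d x′) ⟨
    sum (λ v → indicator (off v) + d x′ v)          ≤⟨ ∑-mono-≤ moving-to-x′ ⟩
    sum (λ v → indicator (between? a z v) + d z v)  ≡⟨ ∑-distrib-+ (indicator ∘ between? a z) (d z) ⟩
    count (between? a z) + sum (d z)                ∎)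
    where
    open ≤-Reasoning
    off : Fin n → Bool
    off = not ∘ between? a z
    moving-to-x′ : ∀ v → indicator (off v) + d x′ v ≤ indicator (between? a z v) + d z v
    moving-to-x′ v with d a z + d z v ≟ d a v
    ... | yes _ = ≤-trans (d-triangle x′ z v) (+-monoˡ-≤ (d z v) (Adj⇒d≤1 (Adj-sym G e)))
    ... | no ¬azv with d x′ v <? d z v
    ...   | yes x′v<zv = x′v<zv
    ...   | no  x′v≮zv = contradiction (Between-sym (Between-through-edge e za (≮⇒≥ x′v≮zv))) ¬azv

  median-majority : ∀ {z a} → IsMedian z → a ≢ z → n ≤ count (between? a z) + count (between? a z)
  median-majority {z} {a} median a≢z = begin
    n                                                  ≡⟨ count-complement (between? a z) ⟨
    count (between? a z) + count (not ∘ between? a z)  ≤⟨ +-monoʳ-≤ _ (median-balanced median a≢z) ⟩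
    count (between? a z) + count (between? a z)        ∎
    where open ≤-Reasoning

nonadj : ∀ {n} → Graph n → Fin n → Fin n → Bool
nonadj G x y = not (adj G x y)

¬Adj⇒T-nonadj : ∀ {n} (G : Graph n) {x y} → ¬ Adj G x y → T (nonadj G x y)
¬Adj⇒T-nonadj G = ¬T⇒T-not

T-nonadj-self : ∀ {n} (G : Graph n) x → T (nonadj G x x)
T-nonadj-self G x = ¬Adj⇒T-nonadj G (λ xx → Adj⇒≢ G xx refl)

¬T-nonadj⇒Adj : ∀ {n} (G : Graph n) {x y} → ¬ T (nonadj G x y) → Adj G x y
¬T-nonadj⇒Adj G = ¬T-not⇒T

min-degree⇒count-nonadj≤ : ∀ {n} (G : Graph n) k x → n ∸ k ≤ degree G x → count (nonadj G x) ≤ k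
min-degree⇒count-nonadj≤ {n} G k x deg = +-cancelʳ-≤ (n ∸ k) _ _ (begin
  count (nonadj G x) + (n ∸ k)          ≤⟨ +-monoʳ-≤ _ (subst (n ∸ k ≤_) (degree≡count G x) deg) ⟩
  count (nonadj G x) + count (adj G x)  ≡⟨ +-comm (count (nonadj G x)) (count (adj G x)) ⟩
  count (adj G x) + count (nonadj G x)  ≡⟨ count-complement (adj G x) ⟩
  n                                     ≤⟨ m≤n+m∸n n k ⟩
  k + (n ∸ k)                           ∎)
  where open ≤-Reasoning

count-nonadj-pair : ∀ {n} (G : Graph n) {x y} → x ≢ y → ¬ Adj G x y →
                    count (λ v → nonadj G x v ∨ nonadj G y v) + 2 ≤
                    count (nonadj G x) + count (nonadj G y)
count-nonadj-pair G {x} {y} x≢y ¬xy =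
  subst (count (λ v → nonadj G x v ∨ nonadj G y v) + 2 ≤_) (count-∨ (nonadj G x) (nonadj G y))
    (+-monoʳ-≤ _ (two-points⇒2≤count (λ v → nonadj G x v ∧ nonadj G y v) x≢y
      (Equivalence.from T-∧ (T-nonadj-self G x , ¬Adj⇒T-nonadj G (¬xy ∘ Adj-sym G)))
      (Equivalence.from T-∧ (¬Adj⇒T-nonadj G ¬xy , T-nonadj-self G y))))

Consistent⇒≡d : ∀ {n} {Q H T : Graph n} (cH : Connected H) (cT : Connected T) → Consistent Q H T →
                ∀ {x y} → Adj Q x y → Distance.d cT x y ≡ Distance.d cH x y
Consistent⇒≡d cH cT consistent {x} {y} xy =
  ≡.sym (Distance.Dist⇒≡d cT (proj₁ (consistent x y xy _) (Distance.Dist-d cH x y)))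

module Reconstruction {n} {T₀ T₁ : Graph n} (t₀ : IsTree T₀) (t₁ : IsTree T₁) where
  module D₀ = TreeDistance t₀
  module D₁ = TreeDistance t₁
  open D₀ using (Between; between?) renaming (d to d₀)
  open D₁ using () renaming (d to d₁)

  Agree : Fin n → Fin n → Set
  Agree x y = d₀ x y ≡ d₁ x y

  Agree-sym : ∀ {x y} → Agree x y → Agree y x
  Agree-sym {x} {y} xy = trans (D₀.d-sym y x) (trans xy (D₁.d-sym x y))

  Agree⇒Dist⇔ : ∀ {x y} → Agree x y → ∀ m →
                (Dist T₀ x y m → Dist T₁ x y m) × (Dist T₁ x y m → Dist T₀ x y m)
  Agree⇒Dist⇔ xy m = (λ D → D₁.≡d⇒Dist (trans (D₀.Dist⇒≡d D) xy))
                    , (λ D → D₀.≡d⇒Dist (trans (D₁.Dist⇒≡d D) (≡.sym xy)))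

  d₀≤d₁-across : ∀ {a z w} → Between a z w → Agree a w → Agree z w → d₀ a z ≤ d₁ a z
  d₀≤d₁-across {a} {z} {w} azw aw zw = +-cancelʳ-≤ (d₀ z w) _ _ (begin
    d₀ a z + d₀ z w  ≡⟨ azw ⟩
    d₀ a w           ≡⟨ aw ⟩
    d₁ a w           ≤⟨ D₁.d-triangle a z w ⟩
    d₁ a z + d₁ z w  ≡⟨ cong (d₁ a z +_) zw ⟨
    d₁ a z + d₀ z w  ∎)
    where open ≤-Reasoning

  d₁≤d₀-across : ∀ {a z w w′} → Between a z w → Between w z w′ →
                 Agree a w → Agree z w → Agree a w′ → Agree z w′ → Agree w w′ → d₁ a z ≤ d₀ a z
  d₁≤d₀-across {a} {z} {w} {w′} azw wzw′ aw zw aw′ zw′ ww′ = +-cancelʳ-≤ (d₀ w w′) _ _ (begin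
    d₁ a z + d₀ w w′                                   ≡⟨ cong (d₁ a z +_) ww′ ⟩
    d₁ a z + d₁ w w′                                   ≤⟨ D₁.four-point a z w w′ ⟩
    (d₁ a w + d₁ z w′) ⊔ (d₁ a w′ + d₁ z w)            ≡⟨ cong₂ _⊔_ (cong₂ _+_ aw zw′) (cong₂ _+_ aw′ zw) ⟨
    (d₀ a w + d₀ z w′) ⊔ (d₀ a w′ + d₀ z w)            ≤⟨ ⊔-lub (≤-reflexive via-w) via-w′ ⟩
    d₀ a z + d₀ w w′                                   ∎)
    where
    open ≤-Reasoning
    wz+zw′ : d₀ a z + (d₀ z w + d₀ z w′) ≡ d₀ a z + d₀ w w′
    wz+zw′ = cong (d₀ a z +_) (trans (cong (_+ d₀ z w′) (D₀.d-sym z w)) wzw′)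
    via-w : d₀ a w + d₀ z w′ ≡ d₀ a z + d₀ w w′
    via-w = trans (cong (_+ d₀ z w′) (≡.sym azw))
                  (trans (+-assoc (d₀ a z) (d₀ z w) (d₀ z w′)) wz+zw′)
    via-w′ : d₀ a w′ + d₀ z w ≤ d₀ a z + d₀ w w′
    via-w′ = begin
      d₀ a w′ + d₀ z w            ≤⟨ +-monoˡ-≤ (d₀ z w) (D₀.d-triangle a z w′) ⟩
      d₀ a z + d₀ z w′ + d₀ z w   ≡⟨ xy∙z≈x∙zy (d₀ a z) (d₀ z w′) (d₀ z w) ⟩
      d₀ a z + (d₀ z w + d₀ z w′) ≡⟨ wz+zw′ ⟩
      d₀ a z + d₀ w w′            ∎

  Agree-across : ∀ {a z w w′} → Between a z w → Between w z w′ →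
                 Agree a w → Agree z w → Agree a w′ → Agree z w′ → Agree w w′ → Agree a z
  Agree-across azw wzw′ aw zw aw′ zw′ ww′ =
    ≤-antisym (d₀≤d₁-across azw aw zw) (d₁≤d₀-across azw wzw′ aw zw aw′ zw′ ww′)

  module _ (Q : Graph n) (agree : ∀ {x y} → Adj Q x y → Agree x y)
           (few-nonadj : ∀ x → count (nonadj Q x) ≤ 3)
           {z} (heavy : ∀ {a} → a ≢ z → 6 < count (between? a z)) where

    nonadj-either : Fin n → Fin n → Fin n → Bool
    nonadj-either x y v = nonadj Q x v ∨ nonadj Q y v

    witness-w : ∀ {a} → a ≢ z → ∃[ w ] (Between a z w × Adj Q z w × Adj Q a w)
    witness-w {a} a≢z =
      let w , azw , w-bad = pigeonhole (between? a z) (nonadj-either z a) (begin-strict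
            count (nonadj-either z a)                ≤⟨ count-∨-≤ (nonadj Q z) (nonadj Q a) ⟩
            count (nonadj Q z) + count (nonadj Q a)  ≤⟨ +-mono-≤ (few-nonadj z) (few-nonadj a) ⟩
            6                                        <⟨ heavy a≢z ⟩
            count (between? a z)                     ∎)
          ¬zw , ¬aw = ¬T-∨ {nonadj Q z w} w-bad
      in w , toWitness azw , ¬T-nonadj⇒Adj Q ¬zw , ¬T-nonadj⇒Adj Q ¬aw
      where open ≤-Reasoning

    -- Excluded are at most 4 non-neighbours of z or a (both a and z are among
    -- them) and at most 2 non-neighbours of w behind z (w itself is not).
    witness-w′ : ∀ {a w} → a ≢ z → ¬ Adj Q z a → Adj Q z w →
                 ∃[ w′ ] (Between w z w′ × Adj Q z w′ × Adj Q a w′ × Adj Q w w′)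
    witness-w′ {a} {w} a≢z ¬za zw =
      let w′ , wzw′ , w′-bad = pigeonhole (between? w z) bad (begin-strict
            count bad                                  ≤⟨ count-∨-≤ (nonadj-either z a) w-side ⟩
            count (nonadj-either z a) + count w-side   ≤⟨ +-mono-≤ z-or-a≤4 w-side≤2 ⟩
            6                                          <⟨ heavy w≢z ⟩
            count (between? w z)                       ∎)
          ¬za∨aw′ , ¬ww′∧wzw′ = ¬T-∨ {nonadj Q z w′ ∨ nonadj Q a w′} w′-bad
          ¬zw′ , ¬aw′ = ¬T-∨ {nonadj Q z w′} ¬za∨aw′
      in w′ , toWitness wzw′ , ¬T-nonadj⇒Adj Q ¬zw′ , ¬T-nonadj⇒Adj Q ¬aw′
            , ¬T-nonadj⇒Adj Q (λ nww′ → ¬ww′∧wzw′ (Equivalence.from T-∧ (nww′ , wzw′)))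
      where
      open ≤-Reasoning
      w≢z : w ≢ z
      w≢z = Adj⇒≢ Q zw ∘ ≡.sym
      w-side : Fin n → Bool
      w-side v = nonadj Q w v ∧ between? w z v
      bad : Fin n → Bool
      bad v = nonadj-either z a v ∨ w-side v
      z-or-a≤4 : count (nonadj-either z a) ≤ 4
      z-or-a≤4 = +-cancelʳ-≤ 2 _ 4 (≤-trans (count-nonadj-pair Q (a≢z ∘ ≡.sym) ¬za)
                                           (+-mono-≤ (few-nonadj z) (few-nonadj a)))
      w-side≤2 : count w-side ≤ 2
      w-side≤2 = ≤-pred (≤-trans
        (count-∧<count (nonadj Q w) (between? w z) (T-nonadj-self Q w)
                       (D₀.¬Between-loop w≢z ∘ toWitness))
        (few-nonadj w))

    Agree-from-z : ∀ a → Agree z a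
    Agree-from-z a with a ≟ᶠ z | T? (adj Q z a)
    ... | yes refl | _      = trans (D₀.d-refl z) (≡.sym (D₁.d-refl z))
    ... | no _     | yes za = agree za
    ... | no a≢z   | no ¬za =
      let w  , azw  , zw  , aw        = witness-w a≢z
          w′ , wzw′ , zw′ , aw′ , ww′ = witness-w′ a≢z ¬za zw
      in Agree-sym (Agree-across azw wzw′ (agree aw) (agree zw) (agree aw′) (agree zw′) (agree ww′))

lemma2p11 : ∀ (n : ℕ) → 13 ≤ n → (Q : Graph n) → (∀ x → n ∸ 3 ≤ degree Q x) →
    (H : Graph n) → IsTree H →
    (T₀ T₁ : Graph n) → IsTree T₀ → IsTree T₁ →
    Consistent Q H T₀ → Consistent Q H T₁ →
    ∃[ z ] (∀ v d → (Dist T₀ z v d → Dist T₁ z v d) × (Dist T₁ z v d → Dist T₀ z v d))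
lemma2p11 n 13≤n Q min-degree H h T₀ T₁ t₀ t₁ c₀ c₁ =
  z , λ v → Agree⇒Dist⇔ (Agree-from-z Q agree few-nonadj heavy v)
  where
  open Reconstruction t₀ t₁
  open Median t₀

  z-median : ∃[ z ] IsMedian z
  z-median = ∃-minimiser (fromℕ< (≤-trans (s≤s z≤n) 13≤n)) (λ y → sum (D₀.d y))

  z : Fin n
  z = proj₁ z-median

  agree : ∀ {x y} → Adj Q x y → Agree x y
  agree xy = trans (Consistent⇒≡d {Q = Q} connected-H (IsTree⇒Connected t₀) c₀ xy)
                   (≡.sym (Consistent⇒≡d {Q = Q} connected-H (IsTree⇒Connected t₁) c₁ xy))
    where
    connected-H : Connected H
    connected-H = IsTree⇒Connected h

  few-nonadj : ∀ x → count (nonadj Q x) ≤ 3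
  few-nonadj x = min-degree⇒count-nonadj≤ Q 3 x (min-degree x)

  heavy : ∀ {a} → a ≢ z → 6 < count (D₀.between? a z)
  heavy a≢z = ≰⇒> λ c≤6 →
    1+n≰n (≤-trans (≤-trans 13≤n (median-majority (proj₂ z-median) a≢z)) (+-mono-≤ c≤6 c≤6))
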